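{- Let $(s(n))_{n\geq 1}$ be the integer sequence defined by $s(1)=0$, $s(2)=1$, $s(3)=1$ and, for all $k\geq 1$, \[ s(4k) = 2s(2k) - s(k),\quad s(4k+1) = 2s(2k) + s(2k+1),\quad s(4k+2) = 2s(2k+1) + s(2k),\quad s(4k+3) = 2s(2k+1) - s(k). \] Define the sequence $(a(n))_{n\geq1}$ by $a(1)=1$ and, for $n\geq 2$, \[ a(n) = \begin{cases} 2a(n-1), & n \equiv 0 \pmod 4;\\ a(n-1)+1, & n\equiv 1 \pmod 4;\\ 2a(n-1)+1, & n\equiv 2\pmod 4;\\ a(n-1)-1, & n\equiv 3\pmod 4.\end{cases} \] Then $s(a(n)) = F_n$ for all $n\geq 1$, where $(F_n)_{n\geq1}$ is the Fibonacci sequence with $F_1=0$, $F_2=1$, $F_{n+1}=F_n+F_{n-1}$. -}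

module Defs where

open import Data.Nat using (ℕ; zero; suc; _+_; _*_; _∸_; _%_)
open import Data.Integer using (ℤ; +_; _-_) renaming (_+_ to _+ℤ_; _*_ to _*ℤ_)
open import Relation.Binary.PropositionalEquality using (_≡_)

a-step : ℕ → ℕ → ℕ
a-step 0 x = 2 * x
a-step 1 x = x + 1
a-step 2 x = 2 * x + 1
a-step _ x = x ∸ 1

-- The sequence a(n) for n ≥ 1 (index literal; a 0 = 0 is an unused junk value).
-- a(1) = 1 and a(n) = a-step (n mod 4) (a(n-1)) for n ≥ 2.
-- (Truncated subtraction is harmless: when n ≡ 3 mod 4, a(n-1) = 2a(n-2)+1 ≥ 1.)
a : ℕ → ℕ
a zero = 0
a (suc zero) = 1
a (suc (suc n)) = a-step (suc (suc n) % 4) (a (suc n))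

-- Fibonacci with F(1) = 0, F(2) = 1, F(n+1) = F(n) + F(n-1)  (F 0 = 1 is junk).
F : ℕ → ℕ
F zero = 1
F (suc zero) = 0
F (suc (suc zero)) = 1
F (suc (suc (suc n))) = F (suc (suc n)) + F (suc n)

-- A sequence s : ℕ → ℤ (values at index ≥ 1 are meaningful) satisfying the
-- defining initial values and recurrences of the paper's s(n).  These determine
-- s(n) uniquely for all n ≥ 1.
record IsS (s : ℕ → ℤ) : Set where
  field
    s1 : s 1 ≡ + 0
    s2 : s 2 ≡ + 1
    s3 : s 3 ≡ + 1
    s4k   : ∀ k → 1 Data.Nat.≤ k → s (4 * k)     ≡ (+ 2) *ℤ s (2 * k) - s k
    s4k+1 : ∀ k → 1 Data.Nat.≤ k → s (4 * k + 1) ≡ (+ 2) *ℤ s (2 * k) +ℤ s (2 * k + 1)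
    s4k+2 : ∀ k → 1 Data.Nat.≤ k → s (4 * k + 2) ≡ (+ 2) *ℤ s (2 * k + 1) +ℤ s (2 * k)
    s4k+3 : ∀ k → 1 Data.Nat.≤ k → s (4 * k + 3) ≡ (+ 2) *ℤ s (2 * k + 1) - s k

-- Write c(m) = 1 + 4 + ⋯ + 4^m.  Unfolding the recursion for a gives
-- a(4m+1) = c(m), a(4m+2) = 2c(m)+1, a(4m+3) = 2c(m), a(4m+4) = 4c(m).
-- It therefore suffices that (s(c), s(2c+1), s(2c)) = (F(4m+1), F(4m+2), F(4m+3))
-- for c = c(m), which propagates from c to 4c+1: each recurrence for s becomes
-- one of the Fibonacci identities 2F(i+2) − F(i) = F(i+3), 2F(i+2) + F(i+1) = F(i+4).
module Submission where

open import Defs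
open import Data.Nat using (ℕ; zero; suc; _≤_) renaming (_+_ to _+ℕ_; _*_ to _*ℕ_)
open import Data.Nat.Properties using (≤-refl; ≤-trans; m≤m+n; m≤n+m; m+n∸n≡m)
open import Data.Nat.DivMod using ([m+kn]%n≡m%n)
import Data.Nat.Tactic.RingSolver as ℕ-Solver
open import Data.Integer using (ℤ; +_; _+_; _*_; _-_)
open import Data.Integer.Tactic.RingSolver using (solve-∀)
open import Data.Product using (_×_; _,_)
open import Relation.Binary.PropositionalEquality
  using (_≡_; refl; trans; cong; cong₂; module ≡-Reasoning)

fib-twice-minus : ∀ i → + 2 * + F (3 +ℕ i) - + F (1 +ℕ i) ≡ + F (4 +ℕ i)
fib-twice-minus i = identity (+ F (1 +ℕ i)) (+ F (2 +ℕ i))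
  where
  identity : ∀ x y → + 2 * (y + x) - x ≡ (y + x) + y
  identity = solve-∀

fib-twice-plus : ∀ i → + 2 * + F (3 +ℕ i) + + F (2 +ℕ i) ≡ + F (5 +ℕ i)
fib-twice-plus i = identity (+ F (1 +ℕ i)) (+ F (2 +ℕ i))
  where
  identity : ∀ x y → + 2 * (y + x) + y ≡ ((y + x) + y) + (y + x)
  identity = solve-∀

repunit₄ : ℕ → ℕ
repunit₄ zero    = 1
repunit₄ (suc m) = 4 *ℕ repunit₄ m +ℕ 1

repunit₄-positive : ∀ m → 1 ≤ repunit₄ m
repunit₄-positive zero    = ≤-refl
repunit₄-positive (suc m) = m≤n+m 1 (4 *ℕ repunit₄ m)

1≤k⇒1≤2k : ∀ {k} → 1 ≤ k → 1 ≤ 2 *ℕ k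
1≤k⇒1≤2k {k} 1≤k = ≤-trans 1≤k (m≤m+n k (k +ℕ 0))

2[2k]+1≡4k+1 : ∀ k → 2 *ℕ (2 *ℕ k) +ℕ 1 ≡ 4 *ℕ k +ℕ 1
2[2k]+1≡4k+1 = ℕ-Solver.solve-∀

2[2k]≡4k : ∀ k → 2 *ℕ (2 *ℕ k) ≡ 4 *ℕ k
2[2k]≡4k = ℕ-Solver.solve-∀

2[4k+1]+1≡4[2k]+3 : ∀ k → 2 *ℕ (4 *ℕ k +ℕ 1) +ℕ 1 ≡ 4 *ℕ (2 *ℕ k) +ℕ 3
2[4k+1]+1≡4[2k]+3 = ℕ-Solver.solve-∀

2[4k+1]≡4[2k]+2 : ∀ k → 2 *ℕ (4 *ℕ k +ℕ 1) ≡ 4 *ℕ (2 *ℕ k) +ℕ 2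
2[4k+1]≡4[2k]+2 = ℕ-Solver.solve-∀

-- Indices are written m * 4 so that suc m * 4 unfolds to 4 + m * 4.
a-4m+1 : ∀ m → a (1 +ℕ m *ℕ 4) ≡ repunit₄ m
a-4m+2 : ∀ m → a (2 +ℕ m *ℕ 4) ≡ 2 *ℕ repunit₄ m +ℕ 1
a-4m+3 : ∀ m → a (3 +ℕ m *ℕ 4) ≡ 2 *ℕ repunit₄ m
a-4m+4 : ∀ m → a (4 +ℕ m *ℕ 4) ≡ 4 *ℕ repunit₄ m

a-4m+1 zero    = refl
a-4m+1 (suc m) = cong₂ a-step ([m+kn]%n≡m%n 5 m 4) (a-4m+4 m)
a-4m+2 m = cong₂ a-step ([m+kn]%n≡m%n 2 m 4) (a-4m+1 m)
a-4m+3 m = trans (cong₂ a-step ([m+kn]%n≡m%n 3 m 4) (a-4m+2 m)) (m+n∸n≡m (2 *ℕ repunit₄ m) 1)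
a-4m+4 m = trans (cong₂ a-step ([m+kn]%n≡m%n 4 m 4) (a-4m+3 m)) (2[2k]≡4k (repunit₄ m))

data Residue4 : ℕ → Set where
  4m+1 : ∀ m → Residue4 (1 +ℕ m *ℕ 4)
  4m+2 : ∀ m → Residue4 (2 +ℕ m *ℕ 4)
  4m+3 : ∀ m → Residue4 (3 +ℕ m *ℕ 4)
  4m+4 : ∀ m → Residue4 (4 +ℕ m *ℕ 4)

residue4 : ∀ n → Residue4 (suc n)
residue4 zero = 4m+1 0
residue4 (suc n) with residue4 n
... | 4m+1 m = 4m+2 m
... | 4m+2 m = 4m+3 m
... | 4m+3 m = 4m+4 m
... | 4m+4 m = 4m+1 (suc m)

module _ (s : ℕ → ℤ) (isS : IsS s) where
  open IsS isS
  open ≡-Reasoning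

  s[4k]≡F : ∀ {k} i → 1 ≤ k → s k ≡ + F (1 +ℕ i) → s (2 *ℕ k) ≡ + F (3 +ℕ i) →
            s (4 *ℕ k) ≡ + F (4 +ℕ i)
  s[4k]≡F {k} i 1≤k sk s2k = begin
    s (4 *ℕ k)                        ≡⟨ s4k k 1≤k ⟩
    + 2 * s (2 *ℕ k) - s k            ≡⟨ cong₂ (λ u v → + 2 * u - v) s2k sk ⟩
    + 2 * + F (3 +ℕ i) - + F (1 +ℕ i) ≡⟨ fib-twice-minus i ⟩
    + F (4 +ℕ i)                      ∎

  s[4k+1]≡F : ∀ {k} i → 1 ≤ k → s (2 *ℕ k) ≡ + F (3 +ℕ i) → s (2 *ℕ k +ℕ 1) ≡ + F (2 +ℕ i) →
              s (4 *ℕ k +ℕ 1) ≡ + F (5 +ℕ i)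
  s[4k+1]≡F {k} i 1≤k s2k s2k+1 = begin
    s (4 *ℕ k +ℕ 1)                       ≡⟨ s4k+1 k 1≤k ⟩
    + 2 * s (2 *ℕ k) + s (2 *ℕ k +ℕ 1)    ≡⟨ cong₂ (λ u v → + 2 * u + v) s2k s2k+1 ⟩
    + 2 * + F (3 +ℕ i) + + F (2 +ℕ i)     ≡⟨ fib-twice-plus i ⟩
    + F (5 +ℕ i)                          ∎

  s[4k+2]≡F : ∀ {k} i → 1 ≤ k → s (2 *ℕ k +ℕ 1) ≡ + F (3 +ℕ i) → s (2 *ℕ k) ≡ + F (2 +ℕ i) →
              s (4 *ℕ k +ℕ 2) ≡ + F (5 +ℕ i)
  s[4k+2]≡F {k} i 1≤k s2k+1 s2k = begin
    s (4 *ℕ k +ℕ 2)                       ≡⟨ s4k+2 k 1≤k ⟩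
    + 2 * s (2 *ℕ k +ℕ 1) + s (2 *ℕ k)    ≡⟨ cong₂ (λ u v → + 2 * u + v) s2k+1 s2k ⟩
    + 2 * + F (3 +ℕ i) + + F (2 +ℕ i)     ≡⟨ fib-twice-plus i ⟩
    + F (5 +ℕ i)                          ∎

  s[4k+3]≡F : ∀ {k} i → 1 ≤ k → s k ≡ + F (1 +ℕ i) → s (2 *ℕ k +ℕ 1) ≡ + F (3 +ℕ i) →
              s (4 *ℕ k +ℕ 3) ≡ + F (4 +ℕ i)
  s[4k+3]≡F {k} i 1≤k sk s2k+1 = begin
    s (4 *ℕ k +ℕ 3)                   ≡⟨ s4k+3 k 1≤k ⟩
    + 2 * s (2 *ℕ k +ℕ 1) - s k       ≡⟨ cong₂ (λ u v → + 2 * u - v) s2k+1 sk ⟩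
    + 2 * + F (3 +ℕ i) - + F (1 +ℕ i) ≡⟨ fib-twice-minus i ⟩
    + F (4 +ℕ i)                      ∎

  s-on-repunit₄ : ℕ → Set
  s-on-repunit₄ m = s c ≡ + F (1 +ℕ m *ℕ 4)
                  × s (2 *ℕ c +ℕ 1) ≡ + F (2 +ℕ m *ℕ 4)
                  × s (2 *ℕ c) ≡ + F (3 +ℕ m *ℕ 4)
    where
    c : ℕ
    c = repunit₄ m

  s[4·repunit₄]≡F : ∀ m → s-on-repunit₄ m → s (4 *ℕ repunit₄ m) ≡ + F (4 +ℕ m *ℕ 4)
  s[4·repunit₄]≡F m (sc , _ , s2c) = s[4k]≡F (m *ℕ 4) (repunit₄-positive m) sc s2c

  s-on-repunit₄-suc : ∀ m → s-on-repunit₄ m → s-on-repunit₄ (suc m)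
  s-on-repunit₄-suc m inv@(sc , s2c+1 , s2c) = s4c+1 , s8c+3 , s8c+2
    where
    c : ℕ
    c = repunit₄ m
    i : ℕ
    i = m *ℕ 4
    1≤c : 1 ≤ c
    1≤c = repunit₄-positive m
    s4c+1 : s (4 *ℕ c +ℕ 1) ≡ + F (5 +ℕ i)
    s4c+1 = s[4k+1]≡F i 1≤c s2c s2c+1
    s2[2c]+1 : s (2 *ℕ (2 *ℕ c) +ℕ 1) ≡ + F (5 +ℕ i)
    s2[2c]+1 = trans (cong s (2[2k]+1≡4k+1 c)) s4c+1
    s2[2c] : s (2 *ℕ (2 *ℕ c)) ≡ + F (4 +ℕ i)
    s2[2c] = trans (cong s (2[2k]≡4k c)) (s[4·repunit₄]≡F m inv)
    s8c+3 : s (2 *ℕ (4 *ℕ c +ℕ 1) +ℕ 1) ≡ + F (6 +ℕ i)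
    s8c+3 = trans (cong s (2[4k+1]+1≡4[2k]+3 c)) (s[4k+3]≡F (2 +ℕ i) (1≤k⇒1≤2k 1≤c) s2c s2[2c]+1)
    s8c+2 : s (2 *ℕ (4 *ℕ c +ℕ 1)) ≡ + F (7 +ℕ i)
    s8c+2 = trans (cong s (2[4k+1]≡4[2k]+2 c)) (s[4k+2]≡F (2 +ℕ i) (1≤k⇒1≤2k 1≤c) s2[2c]+1 s2[2c])

  s-on-all-repunit₄ : ∀ m → s-on-repunit₄ m
  s-on-all-repunit₄ zero    = s1 , s3 , s2
  s-on-all-repunit₄ (suc m) = s-on-repunit₄-suc m (s-on-all-repunit₄ m)

  s∘a≡F : ∀ {n} → Residue4 n → s (a n) ≡ + F n
  s∘a≡F (4m+1 m) with s-on-all-repunit₄ m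
  ... | sc , _ , _     = trans (cong s (a-4m+1 m)) sc
  s∘a≡F (4m+2 m) with s-on-all-repunit₄ m
  ... | _ , s2c+1 , _  = trans (cong s (a-4m+2 m)) s2c+1
  s∘a≡F (4m+3 m) with s-on-all-repunit₄ m
  ... | _ , _ , s2c    = trans (cong s (a-4m+3 m)) s2c
  s∘a≡F (4m+4 m) = trans (cong s (a-4m+4 m)) (s[4·repunit₄]≡F m (s-on-all-repunit₄ m))

proposition9 : (s : ℕ → ℤ) → IsS s → (n : ℕ) → 1 ≤ n → s (a n) ≡ + (F n)
proposition9 s isS (suc n) _ = s∘a≡F s isS (residue4 n)
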